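{- Let $n\ge 4$ and let $\sigma$ be a maximal simplex of $\Delta_n=\mathcal{VR}(\mathbb{I}_n;3)$. Then $\dim(\sigma)\in\{7,\,n+3,\,2n-1\}$. Moreover, if $\dim(\sigma)\neq 7$, then either $\sigma=N(v)\cup N(w)$ for some adjacent vertices $v,w$, or $\sigma=N(u)\cup K_u^{i,j,k}$ for some vertex $u$ and some $i,j,k\in[n]$.
   Context: $\mathbb{I}_n$ is the graph on $\{0,1\}^n$, two strings adjacent iff they differ in exactly one coordinate; distance is the number of differing coordinates. $\Delta_n=\mathcal{VR}(\mathbb{I}_n;3)$ is the simplicial complex whose simplices are the sets of vertices with pairwise distance at most $3$; $\dim\sigma=|\sigma|-1$. For a vertex $v$, $v^{i_1,\dots,i_k}$ is $v$ with coordinates $i_1,\dots,i_k$ flipped and $N(v)=\{v^i:i\in[n]\}$. For distinct $i,j,k\in[n]$, $K_u^{i,j,k}=\{u,u^{i,j},u^{j,k},u^{i,k}\}$. -}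

module Defs where

open import Data.Nat using (ℕ; zero; suc; _+_; _≤_; _∸_)
open import Data.Bool using (Bool; true; false; not)
open import Data.Fin using (Fin)
open import Data.Vec using (Vec; []; _∷_; updateAt)
open import Data.List using (List; length)
open import Data.List.Membership.Propositional using (_∈_; _∉_)
open import Data.List.Relation.Unary.Unique.Propositional using (Unique)
open import Data.Product using (Σ; ∃; _×_; _,_)
open import Data.Sum using (_⊎_)
open import Relation.Binary.PropositionalEquality using (_≡_; _≢_)
open import Relation.Nullary using (¬_)

Vertex : ℕ → Set
Vertex n = Vec Bool n

diff : Bool → Bool → ℕ
diff true  false = 1
diff false true  = 1
diff _     _     = 0

dist : ∀ {n} → Vertex n → Vertex n → ℕ
dist []       []       = 0
dist (a ∷ as) (b ∷ bs) = diff a b + dist as bs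

flip : ∀ {n} → Fin n → Vertex n → Vertex n
flip i v = updateAt v i not

Adjacent : ∀ {n} → Vertex n → Vertex n → Set
Adjacent v w = dist v w ≡ 1

InN : ∀ {n} → Vertex n → Vertex n → Set
InN v x = ∃ λ i → x ≡ flip i v

InK : ∀ {n} → Vertex n → Fin n → Fin n → Fin n → Vertex n → Set
InK u i j k x =
  x ≡ u ⊎ x ≡ flip i (flip j u) ⊎ x ≡ flip j (flip k u) ⊎ x ≡ flip i (flip k u)

-- a finite set of vertices is represented by a duplicate-free list
-- simplex of VR(I_n;3): nonempty, pairwise distance ≤ 3
IsSimplex : ∀ {n} → List (Vertex n) → Set
IsSimplex σ = Unique σ × (∃ λ x → x ∈ σ) ×
  (∀ x y → x ∈ σ → y ∈ σ → dist x y ≤ 3)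

IsMaximalSimplex : ∀ {n} → List (Vertex n) → Set
IsMaximalSimplex {n} σ = IsSimplex σ ×
  (∀ (x : Vertex n) → x ∉ σ → ¬ (∀ y → y ∈ σ → dist x y ≤ 3))

dim : ∀ {n} → List (Vertex n) → ℕ
dim σ = length σ ∸ 1

SetEq : ∀ {n} → List (Vertex n) → (Vertex n → Set) → Set
SetEq {n} σ P = ∀ (x : Vertex n) → (x ∈ σ → P x) × (P x → x ∈ σ)

-- The hypercube is bipartite, and within one colour class of a simplex σ all distances are 2.
-- Writing the members of a class as x and x^S with |S| = 2, these 2-sets S intersect pairwise,
-- so they form a star (giving a common neighbour of the class) or a triangle {pq, qr, pr}
-- (a class of exactly four vertices). Hence a class of size ≠ 4 has a common neighbour c.
-- If a class has at least 5 vertices, c has 5 neighbours in σ, which confines σ to the 2-ball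
-- around c; the vertices of σ at distance 2 from c again form a star or a triangle, giving
-- σ = N(c) ∪ N(c^p) or σ = N(c) ∪ K_c^{p,q,r} by maximality.
-- A class of at most 3 vertices is impossible when n ≥ 4: if some y ∈ σ is at distance 4 from c,
-- some c^m with m among the four coordinates separating c and y is missing from σ, and maximality
-- forces y^m into the class although it is at distance 3 from c; otherwise σ lies in the 2-ball
-- around c and maximality puts all n neighbours of c into the class.
-- Otherwise both classes have exactly four vertices and dim σ = 7.

module Submission where

open import Defs
open import Algebra.Bundles using (CommutativeRing)
open import Data.Bool using (Bool; true; false; not; _xor_)
open import Data.Bool.Properties
  using (not-involutive; ¬-not; not-¬; xor-same; not-distribˡ-xor; not-distribʳ-xor; xor-∧-commutativeRing)
  renaming (_≟_ to _≟ᵇ_)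
open import Data.Empty using (⊥; ⊥-elim)
open import Data.Fin as Fin using (Fin; zero; suc)
import Data.Fin.Properties as Finₚ
open import Data.List using (List; []; _∷_; _++_; length; map; filter; tabulate)
open import Data.List.Properties using (length-++; length-map; length-tabulate)
open import Data.List.Membership.Propositional using (_∈_; _∉_; find)
open import Data.List.Membership.Propositional.Properties
  using (∈-map⁺; ∈-map⁻; ∈-++⁺ˡ; ∈-++⁺ʳ; ∈-++⁻; ∈-∃++; ∈-filter⁺; ∈-filter⁻; ∈-tabulate⁺; ∈-tabulate⁻; ∈-length)
import Data.List.Membership.DecPropositional as DecMembership
open import Data.List.Relation.Binary.Subset.Propositional using (_⊆_)
open import Data.List.Relation.Unary.Any using (here; there; any?)
open import Data.List.Relation.Unary.All as All using ([]; _∷_; all?)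
open import Data.List.Relation.Unary.All.Properties using (¬All⇒Any¬; ¬Any⇒All¬)
open import Data.List.Relation.Unary.Unique.Propositional using (Unique; []; _∷_)
import Data.List.Relation.Unary.Unique.Propositional.Properties as Unique
open import Data.Nat using (ℕ; zero; suc; _+_; _*_; _∸_; _≤_; _<_; z≤n; s≤s; _≤?_)
  renaming (_≟_ to _≟ⁿ_)
open import Data.Nat.Properties
open import Data.Product using (∃; ∃₂; _×_; _,_; proj₁; proj₂)
open import Data.Sum as Sum using (_⊎_; inj₁; inj₂)
open import Data.Vec using ([]; _∷_; lookup)
open import Data.Vec.Properties as Vec using (lookup∘updateAt; lookup∘updateAt′)
open import Function using (_∘_)
open import Relation.Binary.PropositionalEquality
open import Relation.Nullary using (¬_; Dec; yes; no; ¬?; contradiction)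
open import Relation.Nullary.Decidable using (decidable-stable)
open import Relation.Unary using (Decidable)

open import Algebra.Properties.CommutativeSemigroup
  (CommutativeRing.+-commutativeSemigroup xor-∧-commutativeRing)
  using () renaming (interchange to xor-interchange)
open import Algebra.Properties.CommutativeSemigroup +-commutativeSemigroup
  using () renaming (interchange to +-interchange)

private
  variable
    n : ℕ

diff-sym : ∀ a b → diff a b ≡ diff b a
diff-sym true  true  = refl
diff-sym true  false = refl
diff-sym false true  = refl
diff-sym false false = refl

diff-self : ∀ a → diff a a ≡ 0
diff-self true  = refl
diff-self false = refl

diff-triangle : ∀ a b c → diff a c ≤ diff a b + diff b c
diff-triangle true  true  c     = ≤-refl
diff-triangle false false c     = ≤-refl
diff-triangle true  false true  = z≤n
diff-triangle true  false false = s≤s z≤n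
diff-triangle false true  true  = s≤s z≤n
diff-triangle false true  false = z≤n

dist-sym : (u v : Vertex n) → dist u v ≡ dist v u
dist-sym []      []      = refl
dist-sym (a ∷ u) (b ∷ v) = cong₂ _+_ (diff-sym a b) (dist-sym u v)

dist-self : (u : Vertex n) → dist u u ≡ 0
dist-self []      = refl
dist-self (a ∷ u) = cong₂ _+_ (diff-self a) (dist-self u)

dist≡0⇒≡ : (u v : Vertex n) → dist u v ≡ 0 → u ≡ v
dist≡0⇒≡ []          []          _  = refl
dist≡0⇒≡ (true ∷ u)  (true ∷ v)  eq = cong (true ∷_) (dist≡0⇒≡ u v eq)
dist≡0⇒≡ (false ∷ u) (false ∷ v) eq = cong (false ∷_) (dist≡0⇒≡ u v eq)

dist-triangle : (u v w : Vertex n) → dist u w ≤ dist u v + dist v w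
dist-triangle []      []      []      = z≤n
dist-triangle (a ∷ u) (b ∷ v) (c ∷ w) = begin
  diff a c + dist u w                           ≤⟨ +-mono-≤ (diff-triangle a b c) (dist-triangle u v w) ⟩
  (diff a b + diff b c) + (dist u v + dist v w) ≡⟨ +-interchange (diff a b) (diff b c) (dist u v) (dist v w) ⟩
  (diff a b + dist u v) + (diff b c + dist v w) ∎
  where open ≤-Reasoning

DiffersAt : Vertex n → Vertex n → Fin n → Set
DiffersAt u v i = lookup u i ≢ lookup v i

differsAt? : (u v : Vertex n) → Decidable (DiffersAt u v)
differsAt? u v i = ¬? (lookup u i ≟ᵇ lookup v i)

lookup-flip : (i : Fin n) (v : Vertex n) → lookup (flip i v) i ≡ not (lookup v i)
lookup-flip i v = lookup∘updateAt i v

lookup-flip′ : {i j : Fin n} → i ≢ j → (v : Vertex n) → lookup (flip i v) j ≡ lookup v j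
lookup-flip′ {i = i} {j} i≢j v = lookup∘updateAt′ j i (i≢j ∘ sym) v

flip-involutive : (i : Fin n) (v : Vertex n) → flip i (flip i v) ≡ v
flip-involutive zero    (a ∷ v) = cong (_∷ v) (not-involutive a)
flip-involutive (suc i) (a ∷ v) = cong (a ∷_) (flip-involutive i v)

flip-comm : (i j : Fin n) (v : Vertex n) → flip i (flip j v) ≡ flip j (flip i v)
flip-comm zero    zero    (a ∷ v) = refl
flip-comm zero    (suc j) (a ∷ v) = refl
flip-comm (suc i) zero    (a ∷ v) = refl
flip-comm (suc i) (suc j) (a ∷ v) = cong (a ∷_) (flip-comm i j v)

flip-injective : (i j : Fin n) (v : Vertex n) → flip i v ≡ flip j v → i ≡ j
flip-injective i j v eq with i Finₚ.≟ j
... | yes i≡j = i≡j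
... | no  i≢j = contradiction (begin
  lookup v i            ≡⟨ lookup-flip′ (i≢j ∘ sym) v ⟨
  lookup (flip j v) i   ≡⟨ cong (λ w → lookup w i) eq ⟨
  lookup (flip i v) i   ≡⟨ lookup-flip i v ⟩
  not (lookup v i)      ∎) (not-¬ refl)
  where open ≡-Reasoning

flip-cancel : (i : Fin n) {u v : Vertex n} → flip i u ≡ flip i v → u ≡ v
flip-cancel i {u} {v} eq = begin
  u                   ≡⟨ flip-involutive i u ⟨
  flip i (flip i u)   ≡⟨ cong (flip i) eq ⟩
  flip i (flip i v)   ≡⟨ flip-involutive i v ⟩
  v                   ∎
  where open ≡-Reasoning

dist-flip-agreeing : (i : Fin n) (u v : Vertex n) → lookup u i ≡ lookup v i →
                     dist (flip i u) v ≡ suc (dist u v)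
dist-flip-agreeing zero    (true  ∷ u) (.true  ∷ v) refl = refl
dist-flip-agreeing zero    (false ∷ u) (.false ∷ v) refl = refl
dist-flip-agreeing (suc i) (a ∷ u)     (b ∷ v)      eq   =
  trans (cong (diff a b +_) (dist-flip-agreeing i u v eq)) (+-suc (diff a b) (dist u v))

dist-flip-differing : (i : Fin n) (u v : Vertex n) → DiffersAt u v i →
                      suc (dist (flip i u) v) ≡ dist u v
dist-flip-differing zero    (true  ∷ u) (true  ∷ v) ne = contradiction refl ne
dist-flip-differing zero    (true  ∷ u) (false ∷ v) ne = refl
dist-flip-differing zero    (false ∷ u) (true  ∷ v) ne = refl
dist-flip-differing zero    (false ∷ u) (false ∷ v) ne = contradiction refl ne
dist-flip-differing (suc i) (a ∷ u)     (b ∷ v)     ne =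
  trans (sym (+-suc (diff a b) (dist (flip i u) v))) (cong (diff a b +_) (dist-flip-differing i u v ne))

dist-flipˡ : (i : Fin n) (v : Vertex n) → dist (flip i v) v ≡ 1
dist-flipˡ i v = trans (dist-flip-agreeing i v v refl) (cong suc (dist-self v))

dist-flipʳ : (i : Fin n) (v : Vertex n) → dist v (flip i v) ≡ 1
dist-flipʳ i v = trans (dist-sym v (flip i v)) (dist-flipˡ i v)

dist≤3-via-neighbour : (u x y : Vertex n) → dist u x ≡ 1 → dist u y ≤ 2 → dist x y ≤ 3
dist≤3-via-neighbour u x y ux uy =
  ≤-trans (dist-triangle x u y) (+-mono-≤ (≤-reflexive (trans (dist-sym x u) ux)) uy)

dist-flip-≤⇒differsAt : (i : Fin n) (u v : Vertex n) → dist (flip i u) v ≤ dist u v → DiffersAt u v i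
dist-flip-≤⇒differsAt i u v le agree = 1+n≰n (subst (_≤ dist u v) (dist-flip-agreeing i u v agree) le)

diffCoords : Vertex n → Vertex n → List (Fin n)
diffCoords []          []          = []
diffCoords (true ∷ u)  (false ∷ v) = zero ∷ map Fin.suc (diffCoords u v)
diffCoords (false ∷ u) (true ∷ v)  = zero ∷ map Fin.suc (diffCoords u v)
diffCoords (true ∷ u)  (true ∷ v)  = map Fin.suc (diffCoords u v)
diffCoords (false ∷ u) (false ∷ v) = map Fin.suc (diffCoords u v)

length-diffCoords : (u v : Vertex n) → length (diffCoords u v) ≡ dist u v
length-diffCoords []          []          = refl
length-diffCoords (true ∷ u)  (false ∷ v) = cong suc (trans (length-map Fin.suc (diffCoords u v)) (length-diffCoords u v))
length-diffCoords (false ∷ u) (true ∷ v)  = cong suc (trans (length-map Fin.suc (diffCoords u v)) (length-diffCoords u v))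
length-diffCoords (true ∷ u)  (true ∷ v)  = trans (length-map Fin.suc (diffCoords u v)) (length-diffCoords u v)
length-diffCoords (false ∷ u) (false ∷ v) = trans (length-map Fin.suc (diffCoords u v)) (length-diffCoords u v)

private
  zero∉map-suc : (is : List (Fin n)) → zero ∉ map Fin.suc is
  zero∉map-suc is z∈ with ∈-map⁻ Fin.suc z∈
  ... | _ , _ , ()

  ∈-map-suc⁻ : {i : Fin n} (is : List (Fin n)) → suc i ∈ map Fin.suc is → i ∈ is
  ∈-map-suc⁻ is si∈ with ∈-map⁻ Fin.suc si∈
  ... | _ , i∈ , refl = i∈

  map-suc-unique : {is : List (Fin n)} → Unique is → Unique (map Fin.suc is)
  map-suc-unique = Unique.map⁺ Finₚ.suc-injective

  zero∷map-suc-unique : {is : List (Fin n)} → Unique is → Unique (zero ∷ map Fin.suc is)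
  zero∷map-suc-unique {is = is} u =
    All.tabulate (λ i∈ z≡i → zero∉map-suc is (subst (_∈ map Fin.suc is) (sym z≡i) i∈)) ∷ map-suc-unique u

diffCoords-unique : (u v : Vertex n) → Unique (diffCoords u v)
diffCoords-unique []          []          = []
diffCoords-unique (true ∷ u)  (false ∷ v) = zero∷map-suc-unique (diffCoords-unique u v)
diffCoords-unique (false ∷ u) (true ∷ v)  = zero∷map-suc-unique (diffCoords-unique u v)
diffCoords-unique (true ∷ u)  (true ∷ v)  = map-suc-unique (diffCoords-unique u v)
diffCoords-unique (false ∷ u) (false ∷ v) = map-suc-unique (diffCoords-unique u v)

∈-diffCoords⁺ : (u v : Vertex n) (i : Fin n) → DiffersAt u v i → i ∈ diffCoords u v
∈-diffCoords⁺ (true ∷ u)  (false ∷ v) zero    _  = here refl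
∈-diffCoords⁺ (false ∷ u) (true ∷ v)  zero    _  = here refl
∈-diffCoords⁺ (true ∷ u)  (true ∷ v)  zero    ne = contradiction refl ne
∈-diffCoords⁺ (false ∷ u) (false ∷ v) zero    ne = contradiction refl ne
∈-diffCoords⁺ (true ∷ u)  (false ∷ v) (suc i) ne = there (∈-map⁺ Fin.suc (∈-diffCoords⁺ u v i ne))
∈-diffCoords⁺ (false ∷ u) (true ∷ v)  (suc i) ne = there (∈-map⁺ Fin.suc (∈-diffCoords⁺ u v i ne))
∈-diffCoords⁺ (true ∷ u)  (true ∷ v)  (suc i) ne = ∈-map⁺ Fin.suc (∈-diffCoords⁺ u v i ne)
∈-diffCoords⁺ (false ∷ u) (false ∷ v) (suc i) ne = ∈-map⁺ Fin.suc (∈-diffCoords⁺ u v i ne)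

∈-diffCoords⁻ : (u v : Vertex n) (i : Fin n) → i ∈ diffCoords u v → DiffersAt u v i
∈-diffCoords⁻ (true ∷ u)  (false ∷ v) zero    _         = λ ()
∈-diffCoords⁻ (false ∷ u) (true ∷ v)  zero    _         = λ ()
∈-diffCoords⁻ (true ∷ u)  (true ∷ v)  zero    z∈        = contradiction z∈ (zero∉map-suc _)
∈-diffCoords⁻ (false ∷ u) (false ∷ v) zero    z∈        = contradiction z∈ (zero∉map-suc _)
∈-diffCoords⁻ (true ∷ u)  (false ∷ v) (suc i) (there i∈) = ∈-diffCoords⁻ u v i (∈-map-suc⁻ _ i∈)
∈-diffCoords⁻ (false ∷ u) (true ∷ v)  (suc i) (there i∈) = ∈-diffCoords⁻ u v i (∈-map-suc⁻ _ i∈)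
∈-diffCoords⁻ (true ∷ u)  (true ∷ v)  (suc i) i∈         = ∈-diffCoords⁻ u v i (∈-map-suc⁻ _ i∈)
∈-diffCoords⁻ (false ∷ u) (false ∷ v) (suc i) i∈         = ∈-diffCoords⁻ u v i (∈-map-suc⁻ _ i∈)

dist≢0⇒differsAt : (u v : Vertex n) → dist u v ≢ 0 → ∃ (DiffersAt u v)
dist≢0⇒differsAt u v d≢0 with diffCoords u v | length-diffCoords u v | ∈-diffCoords⁻ u v
... | []    | 0≡d | _       = contradiction (sym 0≡d) d≢0
... | i ∷ _ | _   | differs = i , differs i (here refl)

dist≡1⇒InN : (u v : Vertex n) → dist u v ≡ 1 → InN u v
dist≡1⇒InN u v d with dist≢0⇒differsAt u v (λ d≡0 → contradiction (trans (sym d) d≡0) λ ())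
... | i , differs = i , sym (dist≡0⇒≡ (flip i u) v (suc-injective (trans (dist-flip-differing i u v differs) d)))

InN⇒dist≡1 : {u v : Vertex n} → InN u v → dist u v ≡ 1
InN⇒dist≡1 {u = u} (i , refl) = dist-flipʳ i u

towards : Vertex n → Vertex n → List (Vertex n)
towards u v = map (λ i → flip i u) (diffCoords u v)

towards-unique : (u v : Vertex n) → Unique (towards u v)
towards-unique u v = Unique.map⁺ (λ {i} {j} → flip-injective i j u) (diffCoords-unique u v)

length-towards : (u v : Vertex n) → length (towards u v) ≡ dist u v
length-towards u v = trans (length-map _ (diffCoords u v)) (length-diffCoords u v)

flip∈towards : (u v : Vertex n) (i : Fin n) → DiffersAt u v i → flip i u ∈ towards u v
flip∈towards u v i d = ∈-map⁺ (λ j → flip j u) (∈-diffCoords⁺ u v i d)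

∈-towards⁻ : (u v x : Vertex n) → x ∈ towards u v → ∃ λ i → DiffersAt u v i × x ≡ flip i u
∈-towards⁻ u v x x∈ with ∈-map⁻ (λ j → flip j u) x∈
... | i , i∈ , refl = i , ∈-diffCoords⁻ u v i i∈ , refl

neighbours : Vertex n → List (Vertex n)
neighbours v = tabulate (λ i → flip i v)

neighbours-unique : (v : Vertex n) → Unique (neighbours v)
neighbours-unique v = Unique.tabulate⁺ (λ {i} {j} → flip-injective i j v)

length-neighbours : (v : Vertex n) → length (neighbours {n} v) ≡ n
length-neighbours v = length-tabulate _

∈-neighbours⁺ : {v x : Vertex n} → InN v x → x ∈ neighbours v
∈-neighbours⁺ (i , refl) = ∈-tabulate⁺ i

∈-neighbours⁻ : {v x : Vertex n} → x ∈ neighbours v → InN v x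
∈-neighbours⁻ = ∈-tabulate⁻

-- The two colour classes of the bipartite graph 𝕀ₙ

parity : ℕ → Bool
parity zero    = false
parity (suc k) = not (parity k)

parity-+ : ∀ m k → parity (m + k) ≡ parity m xor parity k
parity-+ zero    k = refl
parity-+ (suc m) k = trans (cong not (parity-+ m k)) (not-distribˡ-xor (parity m) (parity k))

parity-diff : ∀ a b → parity (diff a b) ≡ a xor b
parity-diff true  true  = refl
parity-diff true  false = refl
parity-diff false true  = refl
parity-diff false false = refl

even-cases : ∀ k → parity k ≡ false → k ≡ 0 ⊎ k ≡ 2 ⊎ 4 ≤ k
even-cases 0                         _  = inj₁ refl
even-cases 2                         _  = inj₂ (inj₁ refl)
even-cases (suc (suc (suc (suc k)))) _  = inj₂ (inj₂ (s≤s (s≤s (s≤s (s≤s z≤n)))))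
even-cases 1                         ()
even-cases 3                         ()

colour : Vertex n → Bool
colour []      = false
colour (a ∷ v) = a xor colour v

parity-dist : (u v : Vertex n) → parity (dist u v) ≡ colour u xor colour v
parity-dist []      []      = refl
parity-dist (a ∷ u) (b ∷ v) = begin
  parity (diff a b + dist u v)            ≡⟨ parity-+ (diff a b) (dist u v) ⟩
  parity (diff a b) xor parity (dist u v) ≡⟨ cong₂ _xor_ (parity-diff a b) (parity-dist u v) ⟩
  (a xor b) xor (colour u xor colour v)   ≡⟨ xor-interchange a b (colour u) (colour v) ⟩
  (a xor colour u) xor (b xor colour v)   ∎
  where open ≡-Reasoning

colour-flip : (i : Fin n) (v : Vertex n) → colour (flip i v) ≡ not (colour v)
colour-flip zero    (a ∷ v) = sym (not-distribˡ-xor a (colour v))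
colour-flip (suc i) (a ∷ v) = trans (cong (a xor_) (colour-flip i v)) (sym (not-distribʳ-xor a (colour v)))

colour-flip₂ : (i j : Fin n) (v : Vertex n) → colour (flip i (flip j v)) ≡ colour v
colour-flip₂ i j v = trans (colour-flip i (flip j v)) (trans (cong not (colour-flip j v)) (not-involutive (colour v)))

colour-InN : {v x : Vertex n} → InN v x → colour x ≡ not (colour v)
colour-InN {v = v} (i , refl) = colour-flip i v

sameColour-dist : (u v : Vertex n) → colour u ≡ colour v → dist u v ≡ 0 ⊎ dist u v ≡ 2 ⊎ 4 ≤ dist u v
sameColour-dist u v same = even-cases (dist u v)
  (trans (parity-dist u v) (trans (cong (_xor colour v) same) (xor-same (colour v))))

sameColour⇒dist≤2 : (u v : Vertex n) → colour u ≡ colour v → dist u v < 4 → dist u v ≤ 2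
sameColour⇒dist≤2 u v same d<4 with sameColour-dist u v same
... | inj₁ d≡0        = ≤-trans (≤-reflexive d≡0) z≤n
... | inj₂ (inj₁ d≡2) = ≤-reflexive d≡2
... | inj₂ (inj₂ 4≤d) = contradiction d<4 (≤⇒≯ 4≤d)

private
  ∈-++-remove : {A : Set} {x y : A} (us vs : List A) → y ∈ us ++ x ∷ vs → y ≢ x → y ∈ us ++ vs
  ∈-++-remove []       vs (here y≡x)  y≢x = contradiction y≡x y≢x
  ∈-++-remove []       vs (there y∈)  _   = y∈
  ∈-++-remove (u ∷ us) vs (here y≡u)  _   = here y≡u
  ∈-++-remove (u ∷ us) vs (there y∈)  y≢x = there (∈-++-remove us vs y∈ y≢x)

unique⊆⇒length≤ : {A : Set} {xs ys : List A} → Unique xs → xs ⊆ ys → length xs ≤ length ys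
unique⊆⇒length≤ {xs = []}     _            _   = z≤n
unique⊆⇒length≤ {xs = x ∷ xs} (x∉xs ∷ uxs) sub with ∈-∃++ (sub (here refl))
... | us , vs , refl = begin
  suc (length xs)              ≤⟨ s≤s (unique⊆⇒length≤ uxs xs⊆us++vs) ⟩
  suc (length (us ++ vs))      ≡⟨ cong suc (length-++ us) ⟩
  suc (length us + length vs)  ≡⟨ +-suc (length us) (length vs) ⟨
  length us + length (x ∷ vs)  ≡⟨ length-++ us ⟨
  length (us ++ x ∷ vs)        ∎
  where
  open ≤-Reasoning
  xs⊆us++vs : xs ⊆ us ++ vs
  xs⊆us++vs y∈ = ∈-++-remove us vs (sub (there y∈)) (λ y≡x → All.lookup x∉xs y∈ (sym y≡x))

unique⊆⊇⇒length≡ : {A : Set} {xs ys : List A} → Unique xs → Unique ys → xs ⊆ ys → ys ⊆ xs →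
                   length xs ≡ length ys
unique⊆⊇⇒length≡ uxs uys xs⊆ys ys⊆xs = ≤-antisym (unique⊆⇒length≤ uxs xs⊆ys) (unique⊆⇒length≤ uys ys⊆xs)

all-or-counterexample : {A : Set} {P : A → Set} → Decidable P → (xs : List A) →
                        (∀ {x} → x ∈ xs → P x) ⊎ ∃ λ x → x ∈ xs × ¬ P x
all-or-counterexample P? xs with all? P? xs
... | yes all  = inj₁ (All.lookup all)
... | no  ¬all = inj₂ (find (¬All⇒Any¬ P? xs ¬all))

Diam≤3 : List (Vertex n) → Set
Diam≤3 σ = ∀ {x y} → x ∈ σ → y ∈ σ → dist x y ≤ 3

maximal-diam : {σ : List (Vertex n)} → IsMaximalSimplex σ → Diam≤3 σ
maximal-diam ((_ , _ , diam) , _) x∈ y∈ = diam _ _ x∈ y∈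

_∈?_ : (x : Vertex n) (σ : List (Vertex n)) → Dec (x ∈ σ)
x ∈? σ = DecMembership._∈?_ (Vec.≡-dec _≟ᵇ_) x σ

maximal-absorbs : {σ : List (Vertex n)} {x : Vertex n} → IsMaximalSimplex σ →
                  (∀ y → y ∈ σ → dist x y ≤ 3) → x ∈ σ
maximal-absorbs {σ = σ} {x} (_ , maximal) close with x ∈? σ
... | yes x∈σ = x∈σ
... | no  x∉σ = contradiction close (maximal x x∉σ)

ball₁⊆maximal : {σ : List (Vertex n)} {c x : Vertex n} → IsMaximalSimplex σ →
                (∀ {y} → y ∈ σ → dist c y ≤ 2) → dist c x ≤ 1 → x ∈ σ
ball₁⊆maximal {c = c} {x} maxσ ball₂ cx≤1 = maximal-absorbs maxσ λ y y∈σ → begin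
  dist x y            ≤⟨ dist-triangle x c y ⟩
  dist x c + dist c y ≤⟨ +-mono-≤ (subst (_≤ 1) (dist-sym c x) cx≤1) (ball₂ y∈σ) ⟩
  3                   ∎
  where open ≤-Reasoning

colourClass : Bool → List (Vertex n) → List (Vertex n)
colourClass b = filter (λ v → colour v ≟ᵇ b)

colourClass-unique : (b : Bool) {σ : List (Vertex n)} → Unique σ → Unique (colourClass b σ)
colourClass-unique b = Unique.filter⁺ (λ v → colour v ≟ᵇ b)

∈-colourClass⁺ : {b : Bool} {σ : List (Vertex n)} {x : Vertex n} → x ∈ σ → colour x ≡ b → x ∈ colourClass b σ
∈-colourClass⁺ {b = b} = ∈-filter⁺ (λ v → colour v ≟ᵇ b)

∈-colourClass⁻ : {b : Bool} (σ : List (Vertex n)) {x : Vertex n} → x ∈ colourClass b σ → x ∈ σ × colour x ≡ b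
∈-colourClass⁻ {b = b} σ = ∈-filter⁻ (λ v → colour v ≟ᵇ b) {xs = σ}

length-colourClasses : (σ : List (Vertex n)) →
                       length (colourClass true σ) + length (colourClass false σ) ≡ length σ
length-colourClasses []      = refl
length-colourClasses (x ∷ σ) with colour x
... | true  = cong suc (length-colourClasses σ)
... | false = trans (+-suc _ _) (cong suc (length-colourClasses σ))

-- Vertices at distance 2

differsAt-flip : {x t : Vertex n} {i j : Fin n} → j ≢ i → DiffersAt x t i → DiffersAt (flip j x) t i
differsAt-flip {x = x} j≢i differs = differs ∘ trans (sym (lookup-flip′ j≢i x))

module _ (x t : Vertex n) (d≡2 : dist x t ≡ 2) where

  sphere₂-flip : {i : Fin n} → DiffersAt x t i → dist (flip i x) t ≡ 1
  sphere₂-flip {i} differs = suc-injective (trans (dist-flip-differing i x t differs) d≡2)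

  sphere₂-≡flip₂ : {i j : Fin n} → DiffersAt x t i → DiffersAt x t j → i ≢ j → t ≡ flip i (flip j x)
  sphere₂-≡flip₂ {i} {j} dᵢ dⱼ i≢j = sym (dist≡0⇒≡ _ t (suc-injective
    (trans (dist-flip-differing i (flip j x) t (differsAt-flip {x = x} {t} (i≢j ∘ sym) dᵢ)) (sphere₂-flip dⱼ))))

  sphere₂-partner : {q : Fin n} → DiffersAt x t q → ∃ λ r → r ≢ q × DiffersAt x t r × t ≡ flip r (flip q x)
  sphere₂-partner {q} d_q with dist≡1⇒InN (flip q x) t (sphere₂-flip d_q)
  ... | r , t≡ = r , r≢q , dᵣ , t≡
    where
    r≢q : r ≢ q
    r≢q refl = contradiction (begin
      2                                 ≡⟨ d≡2 ⟨
      dist x t                          ≡⟨ cong (dist x) (trans t≡ (flip-involutive q x)) ⟩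
      dist x x                          ≡⟨ dist-self x ⟩
      0                                 ∎) λ ()
      where open ≡-Reasoning
    dᵣ : DiffersAt x t r
    dᵣ agree = not-¬ refl (begin
      lookup x r                        ≡⟨ agree ⟩
      lookup t r                        ≡⟨ cong (λ w → lookup w r) t≡ ⟩
      lookup (flip r (flip q x)) r      ≡⟨ lookup-flip r (flip q x) ⟩
      not (lookup (flip q x) r)         ≡⟨ cong not (lookup-flip′ (r≢q ∘ sym) x) ⟩
      not (lookup x r)                  ∎)
      where open ≡-Reasoning

  sphere₂-flip₂ : ∃₂ λ p q → p ≢ q × t ≡ flip p (flip q x)
  sphere₂-flip₂ with dist≢0⇒differsAt x t (λ d≡0 → contradiction (trans (sym d≡2) d≡0) λ ())
  ... | q , d_q with sphere₂-partner d_q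
  ...   | p , p≢q , _ , t≡ = p , q , p≢q , t≡

  -- The 2-sets {a, b} and {i | DiffersAt x t i} by which x^{ab} and t differ from x must meet.
  sphere₂-meets : {a b : Fin n} → a ≢ b → ¬ DiffersAt x t b → dist (flip a (flip b x)) t ≤ 3 → DiffersAt x t a
  sphere₂-meets {a} {b} a≢b ¬d_b close agree_a = 1+n≰n (subst (_≤ 3) (begin
    dist (flip a (flip b x)) t   ≡⟨ dist-flip-agreeing a (flip b x) t (trans (lookup-flip′ (a≢b ∘ sym) x) agree_a) ⟩
    suc (dist (flip b x) t)      ≡⟨ cong suc (dist-flip-agreeing b x t (decidable-stable (lookup x b ≟ᵇ lookup t b) ¬d_b)) ⟩
    suc (suc (dist x t))         ≡⟨ cong (λ k → suc (suc k)) d≡2 ⟩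
    4                            ∎) close)
    where open ≡-Reasoning

triangle : Vertex n → Fin n → Fin n → Fin n → List (Vertex n)
triangle x p q r = flip p (flip q x) ∷ flip q (flip r x) ∷ flip p (flip r x) ∷ []

Distinct₃ : Fin n → Fin n → Fin n → Set
Distinct₃ p q r = p ≢ q × q ≢ r × p ≢ r

sphere₂-triangle-closed : {x t : Vertex n} {p q r : Fin n} → Distinct₃ p q r → dist x t ≡ 2 →
                          (∀ {s} → s ∈ triangle x p q r → dist s t ≤ 3) → t ∈ triangle x p q r
sphere₂-triangle-closed {x = x} {t} {p} {q} {r} (p≢q , q≢r , p≢r) d≡2 close
  with differsAt? x t p | differsAt? x t q
... | yes d_p | yes d_q = here (sphere₂-≡flip₂ x t d≡2 d_p d_q p≢q)
... | yes d_p | no ¬d_q = there (there (here (sphere₂-≡flip₂ x t d≡2 d_p d_r p≢r)))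
  where
  d_r = sphere₂-meets x t d≡2 (q≢r ∘ sym) ¬d_q
          (subst (λ s → dist s t ≤ 3) (flip-comm q r x) (close (there (here refl))))
... | no ¬d_p | _       = there (here (sphere₂-≡flip₂ x t d≡2 d_q d_r q≢r))
  where
  d_q = sphere₂-meets x t d≡2 (p≢q ∘ sym) ¬d_p
          (subst (λ s → dist s t ≤ 3) (flip-comm p q x) (close (here refl)))
  d_r = sphere₂-meets x t d≡2 (p≢r ∘ sym) ¬d_p
          (subst (λ s → dist s t ≤ 3) (flip-comm p r x) (close (there (there (here refl)))))

-- T is a family of pairwise intersecting 2-sets (the coordinates where t differs from x),
-- and such a family is a star or a triangle.
module _ {x : Vertex n} {T : List (Vertex n)} (on : ∀ {t} → t ∈ T → dist x t ≡ 2) (diam : Diam≤3 T) where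

  private
    meets : {s t : Vertex n} {a b : Fin n} → s ∈ T → t ∈ T → s ≡ flip a (flip b x) → a ≢ b →
            ¬ DiffersAt x t b → DiffersAt x t a
    meets s∈ t∈ refl a≢b ¬d_b = sphere₂-meets x _ (on t∈) a≢b ¬d_b (diam s∈ t∈)

    all-or-missing : (i : Fin n) → (∀ {t} → t ∈ T → DiffersAt x t i) ⊎ ∃ λ t → t ∈ T × ¬ DiffersAt x t i
    all-or-missing i = all-or-counterexample (λ t → differsAt? x t i) T

  sphere₂-star-or-triangle : {t₁ : Vertex n} → t₁ ∈ T →
    (∃ λ p → ∀ {t} → t ∈ T → DiffersAt x t p) ⊎
    (∃ λ p → ∃ λ q → ∃ λ r → Distinct₃ p q r × triangle x p q r ⊆ T)
  sphere₂-star-or-triangle t₁∈ with sphere₂-flip₂ x _ (on t₁∈)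
  ... | p , q , p≢q , t₁≡ with all-or-missing p
  ... | inj₁ all-p = inj₁ (p , all-p)
  ... | inj₂ (t₂ , t₂∈ , ¬d_p₂)
    with sphere₂-partner x _ (on t₂∈) (meets t₁∈ t₂∈ (trans t₁≡ (flip-comm p q x)) (p≢q ∘ sym) ¬d_p₂)
  ... | r , r≢q , d_r₂ , t₂≡ with all-or-missing q
  ... | inj₁ all-q = inj₁ (q , all-q)
  ... | inj₂ (t₃ , t₃∈ , ¬d_q₃) = inj₂ (p , q , r , (p≢q , r≢q ∘ sym , p≢r) , triangle⊆T)
    where
    p≢r : p ≢ r
    p≢r refl = ¬d_p₂ d_r₂
    t₃≡ : t₃ ≡ flip p (flip r x)
    t₃≡ = sphere₂-≡flip₂ x _ (on t₃∈) (meets t₁∈ t₃∈ t₁≡ p≢q ¬d_q₃) (meets t₂∈ t₃∈ t₂≡ r≢q ¬d_q₃) p≢r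
    triangle⊆T : triangle x p q r ⊆ T
    triangle⊆T (here refl)                 = subst (_∈ T) t₁≡ t₁∈
    triangle⊆T (there (here refl))         = subst (_∈ T) (trans t₂≡ (flip-comm r q x)) t₂∈
    triangle⊆T (there (there (here refl))) = subst (_∈ T) t₃≡ t₃∈

StarAround : Vertex n → List (Vertex n) → Set
StarAround x T = ∃ λ p → ∀ {t} → t ∈ T → dist (flip p x) t ≡ 1

TriangleAround : Vertex n → List (Vertex n) → Set
TriangleAround x T = ∃ λ p → ∃ λ q → ∃ λ r → Distinct₃ p q r × triangle x p q r ⊆ T × T ⊆ triangle x p q r

sphere₂-classification : {x : Vertex n} → Fin n → (T : List (Vertex n)) →
                         (∀ {t} → t ∈ T → dist x t ≡ 2) → Diam≤3 T → StarAround x T ⊎ TriangleAround x T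
sphere₂-classification i₀ []      _  _    = inj₁ (i₀ , λ ())
sphere₂-classification {x = x} i₀ (_ ∷ _) on diam with sphere₂-star-or-triangle on diam (here refl)
... | inj₁ (p , all-p) = inj₁ (p , λ {t} t∈ → sphere₂-flip x t (on t∈) (all-p t∈))
... | inj₂ (p , q , r , distinct , triangle⊆T) = inj₂ (p , q , r , distinct , triangle⊆T ,
      λ t∈ → sphere₂-triangle-closed distinct (on t∈) (λ s∈ → diam (triangle⊆T s∈) t∈))

flip₂≢self : {a b : Fin n} → a ≢ b → (x : Vertex n) → flip a (flip b x) ≢ x
flip₂≢self {a = a} {b} a≢b x eq =
  a≢b (sym (flip-injective b a x (flip-cancel a (trans eq (sym (flip-involutive a x))))))

triangle-unique : {p q r : Fin n} → Distinct₃ p q r → (x : Vertex n) → Unique (triangle x p q r)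
triangle-unique {p = p} {q} {r} (p≢q , q≢r , p≢r) x =
  (pq≢qr ∷ pq≢pr ∷ []) ∷ (qr≢pr ∷ []) ∷ [] ∷ []
  where
  pq≢qr : flip p (flip q x) ≢ flip q (flip r x)
  pq≢qr eq = p≢r (flip-injective p r (flip q x) (trans eq (flip-comm q r x)))
  pq≢pr : flip p (flip q x) ≢ flip p (flip r x)
  pq≢pr eq = q≢r (flip-injective q r x (flip-cancel p eq))
  qr≢pr : flip q (flip r x) ≢ flip p (flip r x)
  qr≢pr eq = p≢q (sym (flip-injective q p (flip r x) eq))

monochromatic-commonNeighbour : {b : Bool} → Fin n → (E : List (Vertex n)) → Unique E → Diam≤3 E →
                  (∀ {e} → e ∈ E → colour e ≡ b) → 0 < length E → length E ≢ 4 →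
                  ∃ λ c → ∀ {e} → e ∈ E → dist c e ≡ 1
monochromatic-commonNeighbour i₀ (x ∷ T) (x∉T ∷ uniqueT) diam monochrome _ length≢4
  with sphere₂-classification i₀ T on₂ (λ s∈ t∈ → diam (there s∈) (there t∈))
  where
  on₂ : ∀ {t} → t ∈ T → dist x t ≡ 2
  on₂ {t} t∈ with sameColour-dist x t (trans (monochrome (here refl)) (sym (monochrome (there t∈))))
  ... | inj₁ d≡0        = contradiction (dist≡0⇒≡ _ _ d≡0) (All.lookup x∉T t∈)
  ... | inj₂ (inj₁ d≡2) = d≡2
  ... | inj₂ (inj₂ 4≤d) = contradiction (diam (here refl) (there t∈)) (<⇒≱ 4≤d)
... | inj₁ (p , star) = flip p x , λ { (here refl) → dist-flipˡ p x ; (there t∈) → star t∈ }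
-- Only a triangle around x has no common neighbour, and then |E| = 4.
... | inj₂ (p , q , r , distinct , triangle⊆T , T⊆triangle) =
  contradiction (cong suc (unique⊆⊇⇒length≡ uniqueT (triangle-unique distinct x) T⊆triangle triangle⊆T)) length≢4

-- Maximal simplices with a vertex of degree at least 5

IsN∪N : List (Vertex n) → Set
IsN∪N σ = ∃ λ v → ∃ λ w → Adjacent v w × SetEq σ (λ x → InN v x ⊎ InN w x)

IsN∪K : List (Vertex n) → Set
IsN∪K {n} σ = ∃ λ u → ∃ λ (i : Fin n) → ∃ λ j → ∃ λ k →
  i ≢ j × j ≢ k × i ≢ k × SetEq σ (λ x → InN u x ⊎ InK u i j k x)

fiveNeighbours⇒ball₂ : {σ L : List (Vertex n)} {c : Vertex n} → Diam≤3 σ → Unique L → 5 ≤ length L →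
                       L ⊆ σ → (∀ {e} → e ∈ L → dist c e ≡ 1) → ∀ {y} → y ∈ σ → dist c y ≤ 2
fiveNeighbours⇒ball₂ {L = []}      _ _ () _ _ _
fiveNeighbours⇒ball₂ {L = L@(e₀ ∷ _)} {c} diam uniqueL 5≤|L| L⊆σ adjacent {y} y∈σ with dist c y ≤? 2
... | yes near = near
... | no  far  = contradiction (begin
  length L               ≤⟨ unique⊆⇒length≤ uniqueL L⊆towards ⟩
  length (towards c y)   ≡⟨ length-towards c y ⟩
  dist c y               ≤⟨ dist-triangle c e₀ y ⟩
  dist c e₀ + dist e₀ y  ≤⟨ +-mono-≤ (≤-reflexive (adjacent (here refl))) (diam (L⊆σ (here refl)) y∈σ) ⟩
  4                      ∎) (<⇒≱ 5≤|L|)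
  where
  open ≤-Reasoning
  L⊆towards : L ⊆ towards c y
  L⊆towards e∈ with dist≡1⇒InN c _ (adjacent e∈)
  ... | i , refl = flip∈towards c y i (dist-flip-≤⇒differsAt i c y (≤-trans (diam (L⊆σ e∈) y∈σ) (≰⇒> far)))

ball₂-cases : (c y : Vertex n) → dist c y ≤ 2 → y ≡ c ⊎ InN c y ⊎ dist c y ≡ 2
ball₂-cases c y d≤2 with dist c y in eq | d≤2
... | 0                 | _ = inj₁ (sym (dist≡0⇒≡ c y eq))
... | 1                 | _ = inj₂ (inj₁ (dist≡1⇒InN c y eq))
... | 2                 | _ = inj₂ (inj₂ refl)
... | suc (suc (suc _)) | s≤s (s≤s ())

private
  N∪N-ball₂ : (v w y : Vertex n) → dist v w ≡ 1 → InN v y ⊎ InN w y → dist v y ≤ 2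
  N∪N-ball₂ v w y _  (inj₁ y∈) = ≤-trans (≤-reflexive (InN⇒dist≡1 {u = v} y∈)) (s≤s z≤n)
  N∪N-ball₂ v w y vw (inj₂ y∈) =
    ≤-trans (dist-triangle v w y) (≤-reflexive (cong₂ _+_ vw (InN⇒dist≡1 {u = w} y∈)))

N∪N-diam : (v w x y : Vertex n) → dist v w ≡ 1 → InN v x ⊎ InN w x → InN v y ⊎ InN w y → dist x y ≤ 3
N∪N-diam v w x y vw (inj₁ x∈) y∈ =
  dist≤3-via-neighbour v x y (InN⇒dist≡1 {u = v} x∈) (N∪N-ball₂ v w y vw y∈)
N∪N-diam v w x y vw (inj₂ x∈) y∈ =
  dist≤3-via-neighbour w x y (InN⇒dist≡1 {u = w} x∈) (N∪N-ball₂ w v y (trans (dist-sym w v) vw) (Sum.swap y∈))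

star⇒N∪N : {σ : List (Vertex n)} {c : Vertex n} {p : Fin n} → IsMaximalSimplex σ →
           (∀ {y} → y ∈ σ → dist c y ≤ 2) → (∀ {y} → y ∈ σ → dist c y ≡ 2 → dist (flip p c) y ≡ 1) →
           IsN∪N σ
star⇒N∪N {σ = σ} {c} {p} maxσ ball₂ star = c , flip p c , dist-flipʳ p c , λ x → σ⊆N∪N , N∪N⊆σ
  where
  σ⊆N∪N : ∀ {x} → x ∈ σ → InN c x ⊎ InN (flip p c) x
  σ⊆N∪N {x} x∈ with ball₂-cases c x (ball₂ x∈)
  ... | inj₁ refl       = inj₂ (p , sym (flip-involutive p c))
  ... | inj₂ (inj₁ x∈N) = inj₁ x∈N
  ... | inj₂ (inj₂ d≡2) = inj₂ (dist≡1⇒InN _ _ (star x∈ d≡2))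
  N∪N⊆σ : ∀ {x} → InN c x ⊎ InN (flip p c) x → x ∈ σ
  N∪N⊆σ {x} x∈ = maximal-absorbs maxσ λ y y∈ → N∪N-diam c (flip p c) x y (dist-flipʳ p c) x∈ (σ⊆N∪N y∈)

∈-K⁺ : {c x : Vertex n} {p q r : Fin n} → InK c p q r x → x ∈ c ∷ triangle c p q r
∈-K⁺ (inj₁ eq)                 = here eq
∈-K⁺ (inj₂ (inj₁ eq))          = there (here eq)
∈-K⁺ (inj₂ (inj₂ (inj₁ eq)))   = there (there (here eq))
∈-K⁺ (inj₂ (inj₂ (inj₂ eq)))   = there (there (there (here eq)))

∈-K⁻ : {c x : Vertex n} {p q r : Fin n} → x ∈ c ∷ triangle c p q r → InK c p q r x
∈-K⁻ (here eq)                         = inj₁ eq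
∈-K⁻ (there (here eq))                 = inj₂ (inj₁ eq)
∈-K⁻ (there (there (here eq)))         = inj₂ (inj₂ (inj₁ eq))
∈-K⁻ (there (there (there (here eq)))) = inj₂ (inj₂ (inj₂ eq))

triangle⇒N∪K : {σ : List (Vertex n)} {c : Vertex n} {p q r : Fin n} → IsMaximalSimplex σ →
               (∀ {y} → y ∈ σ → dist c y ≤ 2) → Distinct₃ p q r → triangle c p q r ⊆ σ →
               (∀ {y} → y ∈ σ → dist c y ≡ 2 → y ∈ triangle c p q r) → IsN∪K σ
triangle⇒N∪K {σ = σ} {c} {p} {q} {r} maxσ ball₂ (p≢q , q≢r , p≢r) triangle⊆σ sphere⊆triangle =
  c , p , q , r , p≢q , q≢r , p≢r , λ x → σ⊆N∪K , N∪K⊆σ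
  where
  σ⊆N∪K : ∀ {x} → x ∈ σ → InN c x ⊎ InK c p q r x
  σ⊆N∪K {x} x∈ with ball₂-cases c x (ball₂ x∈)
  ... | inj₁ x≡c        = inj₂ (inj₁ x≡c)
  ... | inj₂ (inj₁ x∈N) = inj₁ x∈N
  ... | inj₂ (inj₂ d≡2) = inj₂ (∈-K⁻ (there (sphere⊆triangle x∈ d≡2)))
  N∪K⊆σ : ∀ {x} → InN c x ⊎ InK c p q r x → x ∈ σ
  N∪K⊆σ (inj₁ x∈N) = ball₁⊆maximal {c = c} maxσ ball₂ (≤-reflexive (InN⇒dist≡1 {u = c} x∈N))
  N∪K⊆σ (inj₂ x∈K) with ∈-K⁺ x∈K
  ... | here refl = ball₁⊆maximal {c = c} maxσ ball₂ (≤-trans (≤-reflexive (dist-self c)) z≤n)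
  ... | there x∈T = triangle⊆σ x∈T

fiveNeighbours⇒shape : {σ L : List (Vertex n)} {c : Vertex n} → Fin n → IsMaximalSimplex σ →
                       Unique L → 5 ≤ length L → L ⊆ σ → (∀ {e} → e ∈ L → dist c e ≡ 1) →
                       IsN∪N σ ⊎ IsN∪K σ
fiveNeighbours⇒shape {n} {σ} {c = c} i₀ maxσ uniqueL 5≤|L| L⊆σ adjacent =
  Sum.map (λ (p , star) → star⇒N∪N {c = c} maxσ ball₂ λ y∈ d≡2 → star (∈S⁺ y∈ d≡2))
          (λ (p , q , r , distinct , triangle⊆S , S⊆triangle) → triangle⇒N∪K {c = c} maxσ ball₂ distinct
             (proj₁ ∘ ∈S⁻ ∘ triangle⊆S) λ y∈ d≡2 → S⊆triangle (∈S⁺ y∈ d≡2))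
          (sphere₂-classification {x = c} i₀ S (proj₂ ∘ ∈S⁻)
             (λ s∈ t∈ → maximal-diam maxσ (proj₁ (∈S⁻ s∈)) (proj₁ (∈S⁻ t∈))))
  where
  S : List (Vertex n)
  S = filter (λ y → dist c y ≟ⁿ 2) σ
  ∈S⁻ : ∀ {y} → y ∈ S → y ∈ σ × dist c y ≡ 2
  ∈S⁻ = ∈-filter⁻ (λ y → dist c y ≟ⁿ 2) {xs = σ}
  ∈S⁺ : ∀ {y} → y ∈ σ → dist c y ≡ 2 → y ∈ S
  ∈S⁺ = ∈-filter⁺ (λ y → dist c y ≟ⁿ 2)
  ball₂ : ∀ {y} → y ∈ σ → dist c y ≤ 2
  ball₂ = fiveNeighbours⇒ball₂ {c = c} (maximal-diam maxσ) uniqueL 5≤|L| L⊆σ adjacent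

length-N∪ : {σ Q : List (Vertex n)} {u : Vertex n} {P : Vertex n → Set} → Unique σ → Unique Q →
            (∀ {x} → x ∈ Q → colour x ≡ colour u) → (∀ {x} → x ∈ Q → P x) → (∀ {x} → P x → x ∈ Q) →
            SetEq σ (λ x → InN u x ⊎ P x) → length σ ≡ n + length Q
length-N∪ {n} {σ} {Q} {u} uniqueσ uniqueQ colourQ Q⊆P P⊆Q σ≈N∪P = begin
  length σ                           ≡⟨ unique⊆⊇⇒length≡ uniqueσ uniqueL σ⊆L L⊆σ ⟩
  length (neighbours u ++ Q)         ≡⟨ length-++ (neighbours u) ⟩
  length (neighbours {n} u) + length Q ≡⟨ cong (_+ length Q) (length-neighbours u) ⟩
  n + length Q                       ∎
  where
  open ≡-Reasoning
  disjoint : ∀ {x} → ¬ (x ∈ neighbours u × x ∈ Q)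
  disjoint (x∈N , x∈Q) =
    not-¬ refl (trans (sym (colourQ x∈Q)) (colour-InN {v = u} (∈-neighbours⁻ x∈N)))
  uniqueL : Unique (neighbours u ++ Q)
  uniqueL = Unique.++⁺ (neighbours-unique u) uniqueQ disjoint
  σ⊆L : σ ⊆ neighbours u ++ Q
  σ⊆L {x} x∈ = Sum.[ ∈-++⁺ˡ ∘ ∈-neighbours⁺ , ∈-++⁺ʳ _ ∘ P⊆Q ] (proj₁ (σ≈N∪P x) x∈)
  L⊆σ : neighbours u ++ Q ⊆ σ
  L⊆σ {x} x∈ = proj₂ (σ≈N∪P x) (Sum.map ∈-neighbours⁻ Q⊆P (∈-++⁻ (neighbours u) x∈))

dim-N∪N : {σ : List (Vertex n)} → Unique σ → IsN∪N σ → dim σ ≡ 2 * n ∸ 1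
dim-N∪N {n} uniqueσ (v , w , vw , σ≈N∪N) = cong (_∸ 1) (begin
  _                                  ≡⟨ length-N∪ uniqueσ (neighbours-unique w) colourN ∈-neighbours⁻ ∈-neighbours⁺ σ≈N∪N ⟩
  n + length (neighbours {n} w)      ≡⟨ cong (n +_) (trans (length-neighbours w) (sym (+-identityʳ n))) ⟩
  2 * n                              ∎)
  where
  open ≡-Reasoning
  colourN : ∀ {x} → x ∈ neighbours w → colour x ≡ colour v
  colourN x∈ = trans (colour-InN {v = w} (∈-neighbours⁻ x∈))
    (trans (cong not (colour-InN {v = v} (dist≡1⇒InN v w vw))) (not-involutive (colour v)))

dim-N∪K : {σ : List (Vertex n)} → Unique σ → IsN∪K σ → dim σ ≡ n + 3
dim-N∪K {n} uniqueσ (u , p , q , r , p≢q , q≢r , p≢r , σ≈N∪K) = cong (_∸ 1) (begin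
  _                       ≡⟨ length-N∪ uniqueσ uniqueK colourK (∈-K⁻ {c = u}) ∈-K⁺ σ≈N∪K ⟩
  n + 4                   ≡⟨ +-suc n 3 ⟩
  suc (n + 3)             ∎)
  where
  open ≡-Reasoning
  uniqueK : Unique (u ∷ triangle u p q r)
  uniqueK = (flip₂≢self p≢q u ∘ sym ∷ flip₂≢self q≢r u ∘ sym ∷ flip₂≢self p≢r u ∘ sym ∷ [])
          ∷ triangle-unique (p≢q , q≢r , p≢r) u
  colourK : ∀ {x} → x ∈ u ∷ triangle u p q r → colour x ≡ colour u
  colourK (here refl)                         = refl
  colourK (there (here refl))                 = colour-flip₂ p q u
  colourK (there (there (here refl)))         = colour-flip₂ q r u
  colourK (there (there (there (here refl)))) = colour-flip₂ p r u

dim-of-shape : {σ : List (Vertex n)} → Unique σ → IsN∪N σ ⊎ IsN∪K σ → dim σ ≡ n + 3 ⊎ dim σ ≡ 2 * n ∸ 1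
dim-of-shape uniqueσ (inj₁ N∪N) = inj₂ (dim-N∪N uniqueσ N∪N)
dim-of-shape uniqueσ (inj₂ N∪K) = inj₁ (dim-N∪K uniqueσ N∪K)

-- Colour classes of a maximal simplex

colourClass-commonNeighbour : {σ : List (Vertex n)} {b : Bool} → Fin n → IsMaximalSimplex σ →
                              0 < length (colourClass b σ) → length (colourClass b σ) ≢ 4 →
                              ∃ λ c → ∀ {e} → e ∈ colourClass b σ → dist c e ≡ 1
colourClass-commonNeighbour {σ = σ} {b} i₀ maxσ@((uniqueσ , _) , _) =
  monochromatic-commonNeighbour i₀ (colourClass b σ) (colourClass-unique b uniqueσ)
    (λ s∈ t∈ → maximal-diam maxσ (proj₁ (∈-colourClass⁻ σ s∈)) (proj₁ (∈-colourClass⁻ σ t∈)))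
    (proj₂ ∘ ∈-colourClass⁻ σ)

colourClass-nonempty : {σ : List (Vertex n)} → Fin n → IsMaximalSimplex σ → (b : Bool) →
                       ∃ λ x → x ∈ colourClass b σ
colourClass-nonempty {σ = σ} i₀ maxσ@((_ , (a , a∈σ) , _) , _) b with any? (λ x → colour x ≟ᵇ b) σ
... | yes found = let x , x∈σ , colour≡b = find found in x , ∈-colourClass⁺ x∈σ colour≡b
... | no  none  = ⊥-elim (not-¬ refl (trans (sym (notB flipa∈σ)) (trans (colour-flip i₀ a) (cong not (notB a∈σ)))))
  where
  notB : ∀ {z} → z ∈ σ → colour z ≡ not b
  notB z∈ = ¬-not (All.lookup (¬Any⇒All¬ σ none) z∈)
  flipa∈σ : flip i₀ a ∈ σ
  flipa∈σ = maximal-absorbs maxσ λ z z∈ → dist≤3-via-neighbour a (flip i₀ a) z (dist-flipʳ i₀ a)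
    (sameColour⇒dist≤2 a z (trans (notB a∈σ) (sym (notB z∈))) (s≤s (maximal-diam maxσ a∈σ z∈)))

module SmallColourClass {σ : List (Vertex n)} (maxσ : IsMaximalSimplex σ) {b : Bool} {c x : Vertex n}
  (around : ∀ {e} → e ∈ colourClass b σ → dist c e ≡ 1) (x∈ : x ∈ colourClass b σ)
  (small : length (colourClass b σ) ≤ 3) where

  colour-c : colour c ≡ not b
  colour-c = trans (sym (not-involutive (colour c)))
    (cong not (trans (sym (colour-InN {v = c} (dist≡1⇒InN c x (around x∈)))) (proj₂ (∈-colourClass⁻ σ x∈))))

  inClass-or-sameColour : ∀ {z} → z ∈ σ → colour z ≡ b ⊎ colour z ≡ colour c
  inClass-or-sameColour {z} z∈ with colour z ≟ᵇ b
  ... | yes colour≡b = inj₁ colour≡b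
  ... | no  colour≢b = inj₂ (trans (¬-not colour≢b) (sym colour-c))

  class⊆towards : ∀ {y} → y ∈ σ → 3 ≤ dist c y → colourClass b σ ⊆ towards c y
  class⊆towards {y} y∈ 3≤d {e} e∈ with dist≡1⇒InN c e (around e∈)
  ... | i , refl = flip∈towards c y i
    (dist-flip-≤⇒differsAt i c y (≤-trans (maximal-diam maxσ (proj₁ (∈-colourClass⁻ σ e∈)) y∈) 3≤d))

  nonadjacent⇒sameColour : ∀ {z} → z ∈ σ → dist c z ≢ 1 → colour z ≡ colour c
  nonadjacent⇒sameColour z∈ d≢1 with inClass-or-sameColour z∈
  ... | inj₁ colour≡b = contradiction (around (∈-colourClass⁺ z∈ colour≡b)) d≢1
  ... | inj₂ same     = same

  -- With no vertex at distance 4, parity confines σ to the 2-ball around c, so maximality puts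
  -- all n neighbours of c into the class.
  no-far-vertex : (∀ {y} → y ∈ σ → dist c y ≢ 4) → n ≤ 3
  no-far-vertex no-far = begin
    n                        ≡⟨ length-neighbours c ⟨
    length (neighbours c)    ≤⟨ unique⊆⇒length≤ (neighbours-unique c) neighbours⊆class ⟩
    length (colourClass b σ) ≤⟨ small ⟩
    3                        ∎
    where
    open ≤-Reasoning
    x∈σ = proj₁ (∈-colourClass⁻ σ x∈)
    ball₂ : ∀ {z} → z ∈ σ → dist c z ≤ 2
    ball₂ {z} z∈ with inClass-or-sameColour z∈
    ... | inj₁ colour≡b = ≤-trans (≤-reflexive (around (∈-colourClass⁺ z∈ colour≡b))) (s≤s z≤n)
    ... | inj₂ same     = sameColour⇒dist≤2 c z (sym same) (≤∧≢⇒< (begin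
      dist c z            ≤⟨ dist-triangle c x z ⟩
      dist c x + dist x z ≤⟨ +-mono-≤ (≤-reflexive (around x∈)) (maximal-diam maxσ x∈σ z∈) ⟩
      4                   ∎) (no-far z∈))
    neighbours⊆class : neighbours c ⊆ colourClass b σ
    neighbours⊆class e∈ with ∈-neighbours⁻ e∈
    ... | i , refl = ∈-colourClass⁺ (ball₁⊆maximal {c = c} maxσ ball₂ (≤-reflexive (dist-flipʳ i c)))
      (trans (colour-flip i c) (trans (cong not colour-c) (not-involutive b)))

  module _ {y : Vertex n} (y∈ : y ∈ σ) (d≡4 : dist c y ≡ 4) where

    private
      3≤d : 3 ≤ dist c y
      3≤d = ≤-trans (s≤s (s≤s (s≤s z≤n))) (≤-reflexive (sym d≡4))
      colour-y : colour y ≡ colour c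
      colour-y = nonadjacent⇒sameColour y∈ (λ d≡1 → contradiction (trans (sym d≡4) d≡1) λ ())

    -- Vertices of the class are c^i with i ≠ m, at distance 2 from y^m; the others are within 2 of y by parity.
    far-flip-close : {m : Fin n} → DiffersAt c y m → flip m c ∉ colourClass b σ →
                     ∀ z → z ∈ σ → dist (flip m y) z ≤ 3
    far-flip-close {m} d_m c^m∉ z z∈ with inClass-or-sameColour z∈
    ... | inj₂ same     = dist≤3-via-neighbour y (flip m y) z (dist-flipʳ m y)
      (sameColour⇒dist≤2 y z (trans colour-y (sym same)) (s≤s (maximal-diam maxσ y∈ z∈)))
    ... | inj₁ colour≡b with ∈-towards⁻ c y z (class⊆towards y∈ 3≤d (∈-colourClass⁺ z∈ colour≡b))
    ...   | i , d_i , refl = ≤-trans (≤-reflexive (suc-injective (begin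
      suc (dist (flip m y) (flip i c))  ≡⟨ dist-flip-differing m y (flip i c) differs-m ⟩
      dist y (flip i c)                 ≡⟨ dist-sym y (flip i c) ⟩
      dist (flip i c) y                 ≡⟨ suc-injective (trans (dist-flip-differing i c y d_i) d≡4) ⟩
      3                                 ∎))) (s≤s (s≤s z≤n))
      where
      open ≡-Reasoning
      i≢m : i ≢ m
      i≢m refl = c^m∉ (∈-colourClass⁺ z∈ colour≡b)
      differs-m : DiffersAt y (flip i c) m
      differs-m eq = d_m (trans (sym (lookup-flip′ i≢m c)) (sym eq))

    far-vertex-impossible : ⊥
    far-vertex-impossible with all-or-counterexample (_∈? colourClass b σ) (towards c y)
    ... | inj₁ towards⊆class = 1+n≰n (begin
      4                         ≡⟨ trans (sym d≡4) (sym (length-towards c y)) ⟩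
      length (towards c y)      ≤⟨ unique⊆⇒length≤ (towards-unique c y) towards⊆class ⟩
      length (colourClass b σ)  ≤⟨ small ⟩
      3                         ∎)
      where open ≤-Reasoning
    ... | inj₂ (w , w∈ , w∉class) with ∈-towards⁻ c y w w∈
    ...   | m , d_m , refl = contradiction (begin
      3                   ≡⟨ suc-injective (trans (dist-flip-differing m y c (d_m ∘ sym)) (trans (dist-sym y c) d≡4)) ⟨
      dist (flip m y) c   ≡⟨ dist-sym (flip m y) c ⟩
      dist c (flip m y)   ≡⟨ around (∈-colourClass⁺ flipy∈σ colour-flipy) ⟩
      1                   ∎) λ ()
      where
      open ≡-Reasoning
      flipy∈σ : flip m y ∈ σ
      flipy∈σ = maximal-absorbs maxσ (far-flip-close d_m w∉class)
      colour-flipy : colour (flip m y) ≡ b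
      colour-flipy = trans (colour-flip m y) (trans (cong not (trans colour-y colour-c)) (not-involutive b))

  impossible : 4 ≤ n → ⊥
  impossible 4≤n with any? (λ y → dist c y ≟ⁿ 4) σ
  ... | yes far = let _ , y∈ , d≡4 = find far in far-vertex-impossible y∈ d≡4
  ... | no  none = 1+n≰n (≤-trans 4≤n (no-far-vertex (All.lookup (¬Any⇒All¬ σ none))))

smallColourClass-impossible : {σ : List (Vertex n)} {b : Bool} → 4 ≤ n → IsMaximalSimplex σ →
                              length (colourClass b σ) ≤ 3 → ⊥
smallColourClass-impossible {n} {σ} {b} 4≤n maxσ small =
  let x , x∈ = colourClass-nonempty i₀ maxσ b
      c , around = colourClass-commonNeighbour i₀ maxσ (∈-length x∈)
                     (λ eq → 1+n≰n (≤-trans (≤-reflexive (sym eq)) small))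
  in SmallColourClass.impossible maxσ {c = c} around x∈ small 4≤n
  where
  i₀ : Fin n
  i₀ = Fin.fromℕ< (≤-trans (s≤s z≤n) 4≤n)

colourClass-≥4 : {σ : List (Vertex n)} → 4 ≤ n → IsMaximalSimplex σ → (b : Bool) → 4 ≤ length (colourClass b σ)
colourClass-≥4 {σ = σ} 4≤n maxσ b with 4 ≤? length (colourClass b σ)
... | yes large  = large
... | no  ¬large = ⊥-elim (smallColourClass-impossible 4≤n maxσ (≤-pred (≰⇒> ¬large)))

largeColourClass⇒shape : {σ : List (Vertex n)} {b : Bool} → Fin n → IsMaximalSimplex σ →
                         5 ≤ length (colourClass b σ) → IsN∪N σ ⊎ IsN∪K σ
largeColourClass⇒shape {σ = σ} {b} i₀ maxσ@((uniqueσ , _) , _) large =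
  let c , around = colourClass-commonNeighbour i₀ maxσ (≤-trans (s≤s z≤n) large) (<⇒≢ large ∘ sym)
  in fiveNeighbours⇒shape {c = c} i₀ maxσ (colourClass-unique b uniqueσ) large (proj₁ ∘ ∈-colourClass⁻ σ) around

dim≡7-or-shape : {σ : List (Vertex n)} → 4 ≤ n → IsMaximalSimplex σ → dim σ ≡ 7 ⊎ IsN∪N σ ⊎ IsN∪K σ
dim≡7-or-shape {n} {σ} 4≤n maxσ =
  classify (5 ≤? length (colourClass true σ)) (5 ≤? length (colourClass false σ))
  where
  i₀ : Fin n
  i₀ = Fin.fromℕ< (≤-trans (s≤s z≤n) 4≤n)
  exactly4 : ∀ b → ¬ 5 ≤ length (colourClass b σ) → length (colourClass b σ) ≡ 4
  exactly4 b ¬large = ≤-antisym (≤-pred (≰⇒> ¬large)) (colourClass-≥4 4≤n maxσ b)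
  classify : Dec (5 ≤ length (colourClass true σ)) → Dec (5 ≤ length (colourClass false σ)) →
             dim σ ≡ 7 ⊎ IsN∪N σ ⊎ IsN∪K σ
  classify (yes large) _           = inj₂ (largeColourClass⇒shape i₀ maxσ large)
  classify (no _)      (yes large) = inj₂ (largeColourClass⇒shape i₀ maxσ large)
  classify (no ¬large) (no ¬large′) = inj₁ (cong (_∸ 1) (begin
    length σ                                                    ≡⟨ length-colourClasses σ ⟨
    length (colourClass true σ) + length (colourClass false σ)  ≡⟨ cong₂ _+_ (exactly4 true ¬large) (exactly4 false ¬large′) ⟩
    8                                                           ∎))
    where open ≡-Reasoning

lemma4p7 : (n : ℕ) → 4 ≤ n → (σ : _) → IsMaximalSimplex {n} σ →
    (dim σ ≡ 7 ⊎ dim σ ≡ n + 3 ⊎ dim σ ≡ 2 * n ∸ 1) ×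
    (dim σ ≢ 7 →
      (∃ λ v → ∃ λ w → Adjacent v w × SetEq σ (λ x → InN v x ⊎ InN w x))
      ⊎ (∃ λ u → ∃ λ (i : Fin n) → ∃ λ j → ∃ λ k →
           i ≢ j × j ≢ k × i ≢ k × SetEq σ (λ x → InN u x ⊎ InK u i j k x)))
lemma4p7 n 4≤n σ maxσ@((uniqueσ , _) , _) with dim≡7-or-shape 4≤n maxσ
... | inj₁ dim≡7 = inj₁ dim≡7 , λ dim≢7 → contradiction dim≡7 dim≢7
... | inj₂ shape = inj₂ (dim-of-shape uniqueσ shape) , λ _ → shape
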